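{- Let $P_2=\{\bot,a,b,\top\}$ and $\mathbf{B}=\{\bot<\top\}$, and let $+:P_2\times\mathbf{B}\to P_2$ be a monotone function satisfying $b+\top\geq a$ and $x+\bot\geq x$ for all $x\in P_2$. If $G$ is a pivoting fork, then $G+\{\top\mid\bot\}$ (the sum with respect to $+$) is a sente pivoting fork.
   Context: $P_2$ is ordered by $\bot<a,b<\top$ with $a,b$ incomparable; a fork is any game form over $P_2$. Game forms over a poset: atomic $[x]$ (written $x$) or composite $\{L\mid R\}$ with $L,R$ nonempty sets of game forms; atomic games have no options. $K^{(L)}$ is a left option of $K$ if $K$ is composite, $K$ itself if atomic; similarly $K^{(R)}$. Mutually recursively: $G\leq H$ iff every $G^{(L)}\lhd H$ and $G\lhd H^{(R)}$ for every $H^{(R)}$; $G\lhd H$ iff some $G^R\leq H$, or some $H^L$ has $G\leq H^L$, or both atomic $[x],[y]$ with $x\leq y$. Sum for monotone $f:A\times B\to C$: $G+_fH=\{G^L+_fH,\,G+_fH^L\mid G^R+_fH,\,G+_fH^R\}$ if one of $G,H$ is composite, $[x]+_f[y]=[f(x,y)]$. A fork $G$ is pivoting if $b\leq G$, or $a\lhd G$ and for every right option $G^R$ there is some $G^{R(L)}$ that is pivoting. A fork $G$ is sente pivoting if $a\lhd G$ and for every right option $G^R$, either $b\leq G^R$ or some $G^{R(L)}$ is sente pivoting. -}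

module Defs where

open import Data.List using (List; []; _∷_; _++_)
open import Data.List.NonEmpty using (List⁺; _∷_; toList; [_])
open import Data.List.Relation.Unary.All using (All)
open import Data.List.Relation.Unary.Any using (Any)
open import Data.Sum using (_⊎_)

data P₂ : Set where
  bot a b top : P₂

data _≤P_ : P₂ → P₂ → Set where
  bot≤ : ∀ {x} → bot ≤P x
  ≤top : ∀ {x} → x ≤P top
  a≤a  : a ≤P a
  b≤b  : b ≤P b

data 𝔹 : Set where
  B0 B1 : 𝔹

data _≤B_ : 𝔹 → 𝔹 → Set where
  B0≤ : ∀ {x} → B0 ≤B x
  B1≤B1 : B1 ≤B B1

Monotone : (P₂ → 𝔹 → P₂) → Set
Monotone f = ∀ {x x' y y'} → x ≤P x' → y ≤B y' → f x y ≤P f x' y'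

data Game (A : Set) : Set where
  atom : A → Game A
  comp : List⁺ (Game A) → List⁺ (Game A) → Game A

leftsP : ∀ {A} → Game A → List⁺ (Game A)
leftsP (atom x)   = [ atom x ]
leftsP (comp L R) = L

rightsP : ∀ {A} → Game A → List⁺ (Game A)
rightsP (atom x)   = [ atom x ]
rightsP (comp L R) = R

rights : ∀ {A} → Game A → List (Game A)
rights (atom x)   = []
rights (comp L R) = toList R

Fork : Set
Fork = Game P₂

data _≤G_ : Fork → Fork → Set
data _⊲_ : Fork → Fork → Set

data _≤G_ where
  le : ∀ {G H} → All (λ gl → gl ⊲ H) (toList (leftsP G))
               → All (λ hr → G ⊲ hr) (toList (rightsP H))
               → G ≤G H

data _⊲_ where
  ⊲R    : ∀ {L R H} → Any (λ gr → gr ≤G H) (toList R) → comp L R ⊲ H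
  ⊲L    : ∀ {G L R} → Any (λ hl → G ≤G hl) (toList L) → G ⊲ comp L R
  ⊲atom : ∀ {x y} → x ≤P y → atom x ⊲ atom y

module _ {A B C : Set} (f : A → B → C) where
  mutual
    sum : Game A → Game B → Game C
    sum (atom x) (atom y) = atom (f x y)
    sum (atom x) (comp L' R') =
      comp (mapR (atom x) L') (mapR (atom x) R')
    sum (comp L R) (atom y) =
      comp (mapL L (atom y)) (mapL R (atom y))
    sum (comp L R) (comp L' R') =
      comp (mapL L (comp L' R') ⁺++⁺ mapR (comp L R) L')
           (mapL R (comp L' R') ⁺++⁺ mapR (comp L R) R')

    mapL : List⁺ (Game A) → Game B → List⁺ (Game C)
    mapL (g ∷ gs) H = sum g H ∷ mapLl gs H

    mapLl : List (Game A) → Game B → List (Game C)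
    mapLl [] H = []
    mapLl (g ∷ gs) H = sum g H ∷ mapLl gs H

    mapR : Game A → List⁺ (Game B) → List⁺ (Game C)
    mapR G (h ∷ hs) = sum G h ∷ mapRl G hs

    mapRl : Game A → List (Game B) → List (Game C)
    mapRl G [] = []
    mapRl G (h ∷ hs) = sum G h ∷ mapRl G hs

    _⁺++⁺_ : List⁺ (Game C) → List⁺ (Game C) → List⁺ (Game C)
    (x ∷ xs) ⁺++⁺ (y ∷ ys) = x ∷ (xs ++ (y ∷ ys))

star : Game 𝔹
star = comp [ atom B1 ] [ atom B0 ]

data Pivoting : Fork → Set where
  piv-b : ∀ {G} → atom b ≤G G → Pivoting G
  piv-a : ∀ {G} → atom a ⊲ G
        → All (λ gr → Any Pivoting (toList (leftsP gr))) (rights G)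
        → Pivoting G

data SentePivoting : Fork → Set where
  spiv : ∀ {G} → atom a ⊲ G
       → All (λ gr → (atom b ≤G gr) ⊎ Any SentePivoting (toList (leftsP gr))) (rights G)
       → SentePivoting G

-- Induction on the derivation that G is pivoting, writing * = {⊤ | ⊥}.
-- Adding * never hurts Left: as x ≤ x + ⊥ ≤ x + ⊤, [x] ≤ H gives [x] ≤ H + *,
-- so a ⊲ G yields a ⊲ G + *; if instead b ≤ G, the left option G + ⊤ is
-- ≥ b + ⊤ ≥ a. The right options of G + * are the G^R + *, answered by a
-- G^{R(L)} + * that is sente pivoting by induction (for atomic G^R = [y] this
-- is y + ⊤ ≥ a), and G + ⊥. The latter is ≥ b when b ≤ G; otherwise some
-- a ≤ G^L, and a ≤ H makes H + ⊥ sente pivoting, since every right option H^R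
-- has a ⊲ H^R and so a sente pivoting left option of H^R + ⊥.
module Submission where

open import Defs
open import Data.List using (_∷_)
open import Data.List.NonEmpty using (toList)
open import Data.List.Relation.Unary.All using (All; []; _∷_)
open import Data.List.Relation.Unary.Any using (Any; here; there)
open import Data.List.Relation.Unary.All.Properties using (++⁺)
open import Data.List.Relation.Unary.Any.Properties using (++⁺ˡ; ++⁺ʳ)
open import Data.Sum using (_⊎_; inj₁; inj₂)

≤P-refl : ∀ x → x ≤P x
≤P-refl bot = bot≤
≤P-refl a   = a≤a
≤P-refl b   = b≤b
≤P-refl top = ≤top

≤P-trans : ∀ {x y z} → x ≤P y → y ≤P z → x ≤P z
≤P-trans bot≤ _    = bot≤
≤P-trans ≤top ≤top = ≤top
≤P-trans a≤a  q    = q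
≤P-trans b≤b  q    = q

≤B-refl : ∀ y → y ≤B y
≤B-refl B0 = B0≤
≤B-refl B1 = B1≤B1

atom-mono-≤ : ∀ {x y} → x ≤P y → atom x ≤G atom y
atom-mono-≤ q = le (⊲atom q ∷ []) (⊲atom q ∷ [])

sentePivoting-atom : ∀ {z} → a ≤P z → SentePivoting (atom z)
sentePivoting-atom q = spiv (⊲atom q) []

HasSentePivotingLeft : Fork → Set
HasSentePivotingLeft K = Any SentePivoting (toList (leftsP K))

SenteRightOption : Fork → Set
SenteRightOption K = atom b ≤G K ⊎ HasSentePivotingLeft K

module _ (f : P₂ → 𝔹 → P₂) (mono : Monotone f) where

  infixl 25 _⊕_
  _⊕_ : Fork → Game 𝔹 → Fork
  G ⊕ H = sum f G H

  module _ (y : 𝔹) where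
    mutual
      -- The two identical clauses only serve to make H ⊕ atom y compute.
      ≤-+atom : ∀ {x x' H} → x' ≤P f x y → atom x ≤G H → atom x' ≤G H ⊕ atom y
      ≤-+atom {H = atom _}   q (le (p ∷ []) rs) = le (⊲-+atom q p ∷ []) (All-⊲-+atom q rs)
      ≤-+atom {H = comp _ _} q (le (p ∷ []) rs) = le (⊲-+atom q p ∷ []) (All-⊲-+atom q rs)

      ⊲-+atom : ∀ {x x' H} → x' ≤P f x y → atom x ⊲ H → atom x' ⊲ H ⊕ atom y
      ⊲-+atom q (⊲L an)   = ⊲L (Any-≤-+atom q an)
      ⊲-+atom q (⊲atom p) = ⊲atom (≤P-trans q (mono p (≤B-refl y)))

      All-⊲-+atom : ∀ {x x' Ks} → x' ≤P f x y → All (atom x ⊲_) Ks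
                  → All (atom x' ⊲_) (mapLl f Ks (atom y))
      All-⊲-+atom q []       = []
      All-⊲-+atom q (p ∷ ps) = ⊲-+atom q p ∷ All-⊲-+atom q ps

      Any-≤-+atom : ∀ {x x' Ks} → x' ≤P f x y → Any (atom x ≤G_) Ks
                  → Any (atom x' ≤G_) (mapLl f Ks (atom y))
      Any-≤-+atom q (here p)  = here (≤-+atom q p)
      Any-≤-+atom q (there p) = there (Any-≤-+atom q p)

  ≤-+⊤⇒⊲-+star : ∀ {x H} → atom x ≤G H ⊕ atom B1 → atom x ⊲ H ⊕ star
  ≤-+⊤⇒⊲-+star {H = atom _}   p = ⊲L (here p)
  ≤-+⊤⇒⊲-+star {H = comp L _} p = ⊲L (++⁺ʳ (mapLl f (toList L) star) (here p))

  module _ (x≤x+⊥ : ∀ x → x ≤P f x B0) where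

    x≤x+⊤ : ∀ x → x ≤P f x B1
    x≤x+⊤ x = ≤P-trans (x≤x+⊥ x) (mono (≤P-refl x) B0≤)

    mutual
      ≤-+star : ∀ {x H} → atom x ≤G H → atom x ≤G H ⊕ star
      ≤-+star {x} {H@(atom _)} x≤H@(le (p ∷ []) _) =
        le (≤-+⊤⇒⊲-+star {H = H} (≤-+atom B1 (x≤x+⊤ x) x≤H) ∷ [])
           (⊲-+atom B0 (x≤x+⊥ x) p ∷ [])
      ≤-+star {x} {H@(comp _ _)} x≤H@(le (p ∷ []) rs) =
        le (≤-+⊤⇒⊲-+star {H = H} (≤-+atom B1 (x≤x+⊤ x) x≤H) ∷ [])
           (++⁺ (All-⊲-+star rs) (⊲-+atom B0 (x≤x+⊥ x) p ∷ []))

      ⊲-+star : ∀ {x H} → atom x ⊲ H → atom x ⊲ H ⊕ star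
      ⊲-+star (⊲atom p)              = ⊲L (here (atom-mono-≤ (≤P-trans p (x≤x+⊤ _))))
      ⊲-+star {H = comp _ _} (⊲L an) = ⊲L (++⁺ˡ (Any-≤-+star an))

      All-⊲-+star : ∀ {x Ks} → All (atom x ⊲_) Ks → All (atom x ⊲_) (mapLl f Ks star)
      All-⊲-+star []       = []
      All-⊲-+star (p ∷ ps) = ⊲-+star p ∷ All-⊲-+star ps

      Any-≤-+star : ∀ {x Ks} → Any (atom x ≤G_) Ks → Any (atom x ≤G_) (mapLl f Ks star)
      Any-≤-+star (here p)  = here (≤-+star p)
      Any-≤-+star (there p) = there (Any-≤-+star p)

    mutual
      a≤⇒sentePivoting-+⊥ : ∀ {H} → atom a ≤G H → SentePivoting (H ⊕ atom B0)
      a≤⇒sentePivoting-+⊥ {atom z} (le (⊲atom q ∷ []) _) =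
        sentePivoting-atom (≤P-trans q (x≤x+⊥ z))
      a≤⇒sentePivoting-+⊥ {comp _ _} (le (p ∷ []) rs) =
        spiv (⊲-+atom B0 (x≤x+⊥ a) p) (All-a⊲⇒senteRightOption-+⊥ rs)

      a⊲⇒sentePivotingLeft-+⊥ : ∀ {K} → atom a ⊲ K → HasSentePivotingLeft (K ⊕ atom B0)
      a⊲⇒sentePivotingLeft-+⊥ (⊲atom q) = here (sentePivoting-atom (≤P-trans q (x≤x+⊥ _)))
      a⊲⇒sentePivotingLeft-+⊥ (⊲L an)   = Any-a≤⇒sentePivoting-+⊥ an

      All-a⊲⇒senteRightOption-+⊥ : ∀ {Ks} → All (atom a ⊲_) Ks
                                  → All SenteRightOption (mapLl f Ks (atom B0))
      All-a⊲⇒senteRightOption-+⊥ []       = []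
      All-a⊲⇒senteRightOption-+⊥ (p ∷ ps) =
        inj₂ (a⊲⇒sentePivotingLeft-+⊥ p) ∷ All-a⊲⇒senteRightOption-+⊥ ps

      Any-a≤⇒sentePivoting-+⊥ : ∀ {Ks} → Any (atom a ≤G_) Ks
                              → Any SentePivoting (mapLl f Ks (atom B0))
      Any-a≤⇒sentePivoting-+⊥ (here p)  = here (a≤⇒sentePivoting-+⊥ p)
      Any-a≤⇒sentePivoting-+⊥ (there p) = there (Any-a≤⇒sentePivoting-+⊥ p)

    module _ (a≤b+⊤ : a ≤P f b B1) where

      b≤⇒a≤+⊤ : ∀ {z} → b ≤P z → a ≤P f z B1
      b≤⇒a≤+⊤ q = ≤P-trans a≤b+⊤ (mono q B1≤B1)

      b≤⇒a⊲-+star : ∀ {H} → atom b ≤G H → atom a ⊲ H ⊕ star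
      b≤⇒a⊲-+star b≤H = ≤-+⊤⇒⊲-+star (≤-+atom B1 a≤b+⊤ b≤H)

      mutual
        b≤⇒sentePivoting-+star : ∀ {H} → atom b ≤G H → SentePivoting (H ⊕ star)
        b≤⇒sentePivoting-+star {atom _} b≤H =
          spiv (b≤⇒a⊲-+star b≤H) (inj₁ (≤-+atom B0 (x≤x+⊥ b) b≤H) ∷ [])
        b≤⇒sentePivoting-+star {comp _ _} b≤H@(le _ rs) =
          spiv (b≤⇒a⊲-+star b≤H)
               (++⁺ (All-b⊲⇒senteRightOption-+star rs)
                    (inj₁ (≤-+atom B0 (x≤x+⊥ b) b≤H) ∷ []))

        b⊲⇒sentePivotingLeft-+star : ∀ {K} → atom b ⊲ K → HasSentePivotingLeft (K ⊕ star)
        b⊲⇒sentePivotingLeft-+star (⊲atom q) =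
          here (sentePivoting-atom (b≤⇒a≤+⊤ q))
        b⊲⇒sentePivotingLeft-+star {comp _ _} (⊲L an) =
          ++⁺ˡ (Any-b≤⇒sentePivoting-+star an)

        All-b⊲⇒senteRightOption-+star : ∀ {Ks} → All (atom b ⊲_) Ks
                                      → All SenteRightOption (mapLl f Ks star)
        All-b⊲⇒senteRightOption-+star []       = []
        All-b⊲⇒senteRightOption-+star (p ∷ ps) =
          inj₂ (b⊲⇒sentePivotingLeft-+star p) ∷ All-b⊲⇒senteRightOption-+star ps

        Any-b≤⇒sentePivoting-+star : ∀ {Ks} → Any (atom b ≤G_) Ks
                                   → Any SentePivoting (mapLl f Ks star)
        Any-b≤⇒sentePivoting-+star (here p)  = here (b≤⇒sentePivoting-+star p)
        Any-b≤⇒sentePivoting-+star (there p) = there (Any-b≤⇒sentePivoting-+star p)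

      pivoting-atom⇒a≤+⊤ : ∀ {z} → Pivoting (atom z) → a ≤P f z B1
      pivoting-atom⇒a≤+⊤ (piv-b (le (⊲atom q ∷ []) _)) = b≤⇒a≤+⊤ q
      pivoting-atom⇒a≤+⊤ (piv-a (⊲atom q) _)           =
        ≤P-trans (x≤x+⊤ a) (mono q B1≤B1)

      pivoting⇒senteRightOption-+⊥ : ∀ {G} → Pivoting G
                                   → SenteRightOption (G ⊕ atom B0)
      pivoting⇒senteRightOption-+⊥ (piv-b b≤G)   = inj₁ (≤-+atom B0 (x≤x+⊥ b) b≤G)
      pivoting⇒senteRightOption-+⊥ (piv-a a⊲G _) = inj₂ (a⊲⇒sentePivotingLeft-+⊥ a⊲G)

      mutual
        pivoting⇒sentePivoting-+star : ∀ {G} → Pivoting G → SentePivoting (G ⊕ star)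
        pivoting⇒sentePivoting-+star (piv-b b≤G) = b≤⇒sentePivoting-+star b≤G
        pivoting⇒sentePivoting-+star {atom _} pG@(piv-a a⊲G []) =
          spiv (⊲-+star a⊲G) (pivoting⇒senteRightOption-+⊥ pG ∷ [])
        pivoting⇒sentePivoting-+star {comp _ _} pG@(piv-a a⊲G rs) =
          spiv (⊲-+star a⊲G)
               (++⁺ (All-pivotingLeft⇒senteRightOption-+star rs)
                    (pivoting⇒senteRightOption-+⊥ pG ∷ []))

        pivotingLeft⇒sentePivotingLeft-+star : ∀ {K} → Any Pivoting (toList (leftsP K))
                                             → HasSentePivotingLeft (K ⊕ star)
        pivotingLeft⇒sentePivotingLeft-+star {atom _}   (here pv) =
          here (sentePivoting-atom (pivoting-atom⇒a≤+⊤ pv))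
        pivotingLeft⇒sentePivotingLeft-+star {comp _ _} an =
          ++⁺ˡ (Any-pivoting⇒sentePivoting-+star an)

        All-pivotingLeft⇒senteRightOption-+star :
          ∀ {Ks} → All (λ K → Any Pivoting (toList (leftsP K))) Ks
                 → All SenteRightOption (mapLl f Ks star)
        All-pivotingLeft⇒senteRightOption-+star []       = []
        All-pivotingLeft⇒senteRightOption-+star {K ∷ _} (p ∷ ps) =
          inj₂ (pivotingLeft⇒sentePivotingLeft-+star {K} p)
            ∷ All-pivotingLeft⇒senteRightOption-+star ps

        Any-pivoting⇒sentePivoting-+star : ∀ {Ks} → Any Pivoting Ks
                                         → Any SentePivoting (mapLl f Ks star)
        Any-pivoting⇒sentePivoting-+star (here p)  = here (pivoting⇒sentePivoting-+star p)
        Any-pivoting⇒sentePivoting-+star (there p) = there (Any-pivoting⇒sentePivoting-+star p)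

proposition6p6 : (f : P₂ → 𝔹 → P₂) → Monotone f
               → a ≤P f b B1
               → (∀ x → x ≤P f x B0)
               → (G : Fork) → Pivoting G
               → SentePivoting (sum f G star)
proposition6p6 f mono a≤b+⊤ x≤x+⊥ G =
  pivoting⇒sentePivoting-+star f mono x≤x+⊥ a≤b+⊤ {G}
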